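{- Let $G$ be a finite bipartite graph on $\Sigma_1=\{0,\dots,N-1\}$ with nonempty bipartition classes $V_1,V_2$ and minimal degree $d_{\min}$, let $G_n$ be as in the context, and let $G_n^{\mathrm r}$ be the random graph defined in the context with $M_n=c_nN^n$, where $\lim_{n\to\infty}c_n=\infty$. Then for a uniformly chosen vertex $V$ of $G_n^{\mathrm r}$, $$\mathbb P(\deg(V)=0)\le e^{ -d_{\min}c_n},$$ where $\deg(V)$ is the number of vertices $j\ne V$ adjacent to $V$ in $G_n^{\mathrm r}$ (loops not counted); in particular the expected fraction of isolated vertices of $G_n^{\mathrm r}$ tends to $0$ as $n\to\infty$.
   Context: Edge set $E(G)$; each edge joins $V_1$ to $V_2$. $\mathrm{typ}(x)=i$ if $x\in V_i$; for a word over $\Sigma_1$, its type is $i$ if all letters lie in $V_i$, else $0$. For distinct $\underline x,\underline y\in\Sigma_n=\Sigma_1^n$ let $k$ be the length of their longest common prefix and $\tilde{\underline x},\tilde{\underline y}$ the remaining postfixes. $G_n$ is the graph on $\Sigma_n$ with a loop at every vertex and distinct $\underline x,\underline y$ adjacent iff $\{\mathrm{typ}(\tilde{\underline x}),\mathrm{typ}(\tilde{\underline y})\}=\{1,2\}$ and $\{x_i,y_i\}\in E(G)$ for all $k<i\le n$. Random graph $G_n^{\mathrm r}$: let $X^{(0)},\dots,X^{(M_n)}$ be i.i.d. uniform on $[0,1]$ with $N$-adic expansions $X^{(i)}=\sum_{k\ge1}X^i_kN^{ -k}$, $X^i_k\in\Sigma_1$. The vertex set is $\{0,1,\dots,M_n\}$,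 and distinct vertices $i,j$ are adjacent iff the words $(X^i_1\dots X^i_n)$ and $(X^j_1\dots X^j_n)$ are equal or adjacent in $G_n$ (equivalently: $M_n+1$ balls are thrown independently and uniformly into urns indexed by $\Sigma_n$, and two balls are joined iff their urns are equal or adjacent in $G_n$). -}

module Defs where

open import Data.Bool using (Bool; true; false; _∧_; _∨_; if_then_else_; T)
open import Data.Nat as ℕ using (ℕ; zero; suc)
open import Data.Integer using (+_)
open import Data.Fin using (Fin; _≟_)
open import Data.Vec using (Vec; []; _∷_)
open import Data.List using (List; []; _∷_; map; concatMap; length; filter)
open import Data.Bool.ListAction using (and)
open import Data.Nat.ListAction using (sum)
open import Data.List using (allFin) public
open import Data.Product using (_×_; ∃)
open import Relation.Nullary.Decidable using (does; ⌊_⌋)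
open import Relation.Nullary using (¬_)
open import Relation.Binary.PropositionalEquality using (_≡_; _≢_)
open import Data.Rational using (ℚ; _/_; _*_; _+_; 0ℚ; 1ℚ)

-- The base graph G on Σ₁ = Fin N.
-- side x = true  means x ∈ V₁,  side x = false means x ∈ V₂.
-- E x y = true means {x,y} ∈ E(G).

record BipartiteGraph (N : ℕ) : Set where
  field
    side     : Fin N → Bool
    E        : Fin N → Fin N → Bool
    E-sym    : ∀ x y → E x y ≡ E y x
    E-across : ∀ x y → T (E x y) → side x ≢ side y
    V₁-nonempty : ∃ λ x → side x ≡ true
    V₂-nonempty : ∃ λ x → side x ≡ false

module _ {N : ℕ} (G : BipartiteGraph N) where
  open BipartiteGraph G

  deg : Fin N → ℕ
  deg x = length (filter (λ y → T? (E x y)) (allFin N))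
    where
    open import Data.Bool.Properties using () renaming (T? to T?)

  IsMinDegree : ℕ → Set
  IsMinDegree d = (∀ x → d ℕ.≤ deg x) × ∃ λ x → deg x ≡ d

  allSide : Bool → ∀ {m} → Vec (Fin N) m → Bool
  allSide b [] = true
  allSide b (a ∷ w) = ⌊ Data.Bool._≟_ b (side a) ⌋ ∧ allSide b w
    where import Data.Bool

  allEdges : ∀ {m} → Vec (Fin N) m → Vec (Fin N) m → Bool
  allEdges [] [] = true
  allEdges (a ∷ x) (b ∷ y) = E a b ∧ allEdges x y

  -- postfix condition: {typ x̃, typ ỹ} = {1,2} and letterwise edges
  postAdj : ∀ {m} → Vec (Fin N) m → Vec (Fin N) m → Bool
  postAdj x y = allEdges x y ∧
    ((allSide true x ∧ allSide false y) ∨ (allSide false x ∧ allSide true y))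

  -- x and y are equal or adjacent in G_n: strip the longest common
  -- prefix, then apply the postfix condition.
  nearₙ : ∀ {n} → Vec (Fin N) n → Vec (Fin N) n → Bool
  nearₙ [] [] = true
  nearₙ (a ∷ x) (b ∷ y) =
    if does (a ≟ b) then nearₙ x y else postAdj (a ∷ x) (b ∷ y)

  words : (n : ℕ) → List (Vec (Fin N) n)
  words zero = [] ∷ []
  words (suc n) = concatMap (λ a → map (a ∷_) (words n)) (allFin N)

  -- all configurations: ball i (i < m) placed in urn c_i ∈ Σₙ
  configs : (n m : ℕ) → List (Vec (Vec (Fin N) n) m)
  configs n zero = [] ∷ []
  configs n (suc m) =
    concatMap (λ w → map (w ∷_) (configs n m)) (words n)

  isolated : ∀ {n m} → Vec (Vec (Fin N) n) m → Fin m → Bool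
  isolated {m = m} c i =
    and (map (λ j → does (i ≟ j) ∨ Data.Bool.not (nearₙ (lookup c i) (lookup c j)))
                  (allFin m))
    where import Data.Bool
          open import Data.Vec using (lookup)

  countIsolated : ∀ {n m} → Vec (Vec (Fin N) n) m → ℕ
  countIsolated {m = m} c =
    length (filter (λ i → T? (isolated c i)) (allFin m))
    where open import Data.Bool.Properties using () renaming (T? to T?)

-- a / b as a rational, with the convention a / 0 = 0 (never used: b > 0 below)
frac : ℕ → ℕ → ℚ
frac a zero = 0ℚ
frac a (suc b) = (+ a) / suc b

module _ {N : ℕ} (G : BipartiteGraph N) where
  -- P(deg(V) = 0) for Gₙʳ with M+1 balls and V uniform on {0,…,M}
  -- (= expected fraction of isolated vertices):
  -- Σ_c #isolated(c) / ((M+1) · (Nⁿ)^(M+1)).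
  probIsolated : (n M : ℕ) → ℚ
  probIsolated n M =
    frac (sum (map (countIsolated G) (configs G n (suc M))))
         (suc M ℕ.* (N ℕ.^ n) ℕ.^ suc M)

_^ℚ_ : ℚ → ℕ → ℚ
q ^ℚ zero = 1ℚ
q ^ℚ suc k = q * (q ^ℚ k)

expPartial : ℚ → ℕ → ℚ
expPartial y zero = 0ℚ
expPartial y (suc K) = expPartial y K + (y ^ℚ K) * frac 1 (K ℕ.!)

-- ExpLe x y  means  x ≤ e^{-y}  (for y ≥ 0), i.e. x · e^{y} ≤ 1,
-- i.e. x · Σ_{k<K} y^k/k! ≤ 1 for every K.
ExpLe : ℚ → ℚ → Set
ExpLe x y = ∀ K → x * expPartial y K Data.Rational.≤ 1ℚ
  where import Data.Rational

-- Write W = Nⁿ for the number of urns and d for the minimal degree of G.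
-- Every word x ∈ Σₙ is equal or adjacent in Gₙ to at least d + 1 words:
-- itself, and the d words obtained by replacing the first letter of x by
-- a G-neighbour.  So each urn is avoided by at most e = W - (d + 1) urns,
-- and, the balls being independent, a fixed ball is isolated in at most
-- W·e^M of the W^(M+1) configurations of M + 1 balls.  Hence
-- P(deg V = 0) ≤ (1 - a)^M ≤ e^{-aM} with a = dd/W for any dd ≤ d + 1:
-- dd = d gives the stated bound, dd = d + 1 (never zero) the limit,
-- through e^y ≥ 1 + y and c_n → ∞.
module Submission where

open import Defs
open import Data.Nat using (ℕ; _≤_; _*_; _^_)
open import Data.Rational using (ℚ; _<_; 0ℚ)
open import Data.Rational using () renaming (_≤_ to _≤ℚ_; _*_ to _*ℚ_)
open import Data.Integer using (+_)
open import Data.Product using (_×_; ∃)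

open import Data.Nat using (zero; suc; _+_; _∸_; _!; z≤n; s≤s; _≤?_)
import Data.Nat.Properties as ℕP
import Data.Nat.Solver as ℕS
import Data.Integer as ℤ
import Data.Integer.Properties as ℤP
open import Data.Rational as Q using (1ℚ; mkℚ; toℚᵘ)
import Data.Rational.Properties as QP
import Data.Rational.Solver as QS
open import Data.Rational.Unnormalised as U using (ℚᵘ; mkℚᵘ; *≡*)
import Data.Rational.Unnormalised.Properties as UP
open import Relation.Binary.PropositionalEquality
open import Data.Product using (_,_; proj₁)
open import Data.Empty using (⊥-elim)
open import Relation.Nullary using (Dec; yes; no; does)
open import Relation.Nullary.Decidable using (dec-true)
open import Data.Bool using (Bool; true; false; _∧_; _∨_; not; T)
open import Data.Bool.Properties using (T?)
open import Data.Bool.ListAction using (and)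
open import Data.List using (List; []; _∷_; map; concatMap; length; filter)
import Data.List.Properties as LP
open import Data.List.Membership.Propositional using (_∈_)
open import Data.List.Membership.Propositional.Properties using (∈-allFin)
open import Data.List.Relation.Unary.Any using (here; there)
open import Data.Nat.ListAction using (sum)
import Data.Nat.ListAction.Properties as SumP
open import Data.Fin using (Fin; _≟_) renaming (zero to fzero; suc to fsuc)
open import Data.Vec using (Vec; []; _∷_; lookup)
open import Function using (_∘_; id)
open import Algebra.Properties.CommutativeSemigroup ℕP.*-commutativeSemigroup using (x∙yz≈y∙xz)

ι : ℕ → ℚ
ι n = frac n 1

viaUnnormalised : ∀ {p q : ℚ} (r s : ℚᵘ) →
  toℚᵘ p U.≃ r → toℚᵘ q U.≃ s → r U.≃ s → p ≡ q
viaUnnormalised r s p≃r q≃s r≃s =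
  QP.toℚᵘ-injective (UP.≃-trans p≃r (UP.≃-trans r≃s (UP.≃-sym q≃s)))

toℚᵘ-frac : ∀ a w → toℚᵘ (frac a (suc w)) U.≃ mkℚᵘ (+ a) w
toℚᵘ-frac a w = QP.toℚᵘ-fromℚᵘ (mkℚᵘ (+ a) w)

ι-+ : ∀ m n → ι (m + n) ≡ ι m Q.+ ι n
ι-+ m n = viaUnnormalised _ (mkℚᵘ (+ m) 0 U.+ mkℚᵘ (+ n) 0) (toℚᵘ-frac (m + n) 0)
  (UP.≃-trans (QP.toℚᵘ-homo-+ (ι m) (ι n)) (UP.+-cong (toℚᵘ-frac m 0) (toℚᵘ-frac n 0)))
  (*≡* (cong (ℤ._* + 1) (trans (ℤP.pos-+ m n)
     (sym (cong₂ ℤ._+_ (ℤP.*-identityʳ (+ m)) (ℤP.*-identityʳ (+ n)))))))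

ι-* : ∀ m n → ι (m * n) ≡ ι m Q.* ι n
ι-* m n = viaUnnormalised _ (mkℚᵘ (+ m) 0 U.* mkℚᵘ (+ n) 0) (toℚᵘ-frac (m * n) 0)
  (UP.≃-trans (QP.toℚᵘ-homo-* (ι m) (ι n)) (UP.*-cong (toℚᵘ-frac m 0) (toℚᵘ-frac n 0)))
  (*≡* (cong (ℤ._* + 1) (ℤP.pos-* m n)))

frac-split : ∀ a D → 1 ≤ D → frac a D ≡ ι a Q.* frac 1 D
frac-split a (suc w) _ = viaUnnormalised _ (mkℚᵘ (+ a) 0 U.* mkℚᵘ (+ 1) w) (toℚᵘ-frac a w)
  (UP.≃-trans (QP.toℚᵘ-homo-* (ι a) (frac 1 (suc w))) (UP.*-cong (toℚᵘ-frac a 0) (toℚᵘ-frac 1 w)))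
  (*≡* (cong₂ ℤ._*_ (sym (ℤP.*-identityʳ (+ a))) (cong (λ k → + suc k) (ℕP.+-identityʳ w))))

frac-inverse : ∀ D → 1 ≤ D → ι D Q.* frac 1 D ≡ 1ℚ
frac-inverse (suc w) D≥1 = trans (sym (frac-split (suc w) (suc w) D≥1))
  (viaUnnormalised _ _ (toℚᵘ-frac (suc w) w) (UP.≃-refl {1ℚᵘ}) (*≡* (ℤP.*-comm (+ suc w) (+ 1))))
  where open U using (1ℚᵘ)

frac-inverse-* : ∀ x y → 1 ≤ x → 1 ≤ y → frac 1 (x * y) ≡ frac 1 x Q.* frac 1 y
frac-inverse-* x y x≥1 y≥1 = begin
    f
  ≡⟨ solve 1 (λ f → f := f :* (con 1ℚ :* con 1ℚ)) refl f ⟩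
    f Q.* (1ℚ Q.* 1ℚ)
  ≡⟨ cong₂ (λ u v → f Q.* (u Q.* v)) (sym (frac-inverse x x≥1)) (sym (frac-inverse y y≥1)) ⟩
    f Q.* ((ι x Q.* frac 1 x) Q.* (ι y Q.* frac 1 y))
  ≡⟨ solve 5 (λ f a b c d → f :* ((a :* b) :* (c :* d)) := ((a :* c) :* f) :* (b :* d))
       refl f (ι x) (frac 1 x) (ι y) (frac 1 y) ⟩
    ((ι x Q.* ι y) Q.* f) Q.* (frac 1 x Q.* frac 1 y)
  ≡⟨ cong (λ z → (z Q.* f) Q.* (frac 1 x Q.* frac 1 y)) (sym (ι-* x y)) ⟩
    (ι (x * y) Q.* f) Q.* (frac 1 x Q.* frac 1 y)
  ≡⟨ cong (Q._* (frac 1 x Q.* frac 1 y)) (frac-inverse (x * y) (ℕP.*-mono-≤ x≥1 y≥1)) ⟩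
    1ℚ Q.* (frac 1 x Q.* frac 1 y)
  ≡⟨ QP.*-identityˡ _ ⟩
    frac 1 x Q.* frac 1 y
  ∎
  where open ≡-Reasoning
        open QS.+-*-Solver
        f : ℚ
        f = frac 1 (x * y)

pow-positive : ∀ W k → 1 ≤ W → 1 ≤ W ^ k
pow-positive W zero W≥1 = ℕP.≤-refl
pow-positive W (suc k) W≥1 = ℕP.*-mono-≤ W≥1 (pow-positive W k W≥1)

frac-inverse-^ : ∀ W k → 1 ≤ W → frac 1 (W ^ k) ≡ frac 1 W ^ℚ k
frac-inverse-^ W zero W≥1 = refl
frac-inverse-^ W (suc k) W≥1 =
  trans (frac-inverse-* W (W ^ k) W≥1 (pow-positive W k W≥1)) (cong (frac 1 W Q.*_) (frac-inverse-^ W k W≥1))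

*-monoˡ-≤ : ∀ {r p q} → 0ℚ ≤ℚ r → p ≤ℚ q → r Q.* p ≤ℚ r Q.* q
*-monoˡ-≤ {r} r≥0 = QP.*-monoˡ-≤-nonNeg r {{Q.nonNegative r≥0}}

*-monoʳ-≤ : ∀ {r p q} → 0ℚ ≤ℚ r → p ≤ℚ q → p Q.* r ≤ℚ q Q.* r
*-monoʳ-≤ {r} r≥0 = QP.*-monoʳ-≤-nonNeg r {{Q.nonNegative r≥0}}

*-nonNeg : ∀ {p q} → 0ℚ ≤ℚ p → 0ℚ ≤ℚ q → 0ℚ ≤ℚ p Q.* q
*-nonNeg {p} {q} p≥0 q≥0 = QP.≤-trans (QP.≤-reflexive (sym (QP.*-zeroˡ q))) (*-monoʳ-≤ q≥0 p≥0)

frac-nonNeg : ∀ a D → 0ℚ ≤ℚ frac a D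
frac-nonNeg a zero = QP.≤-refl
frac-nonNeg a (suc D) = QP.nonNegative⁻¹ (frac a (suc D)) {{QP.normalize-nonNeg a (suc D)}}

ι-nonNeg : ∀ n → 0ℚ ≤ℚ ι n
ι-nonNeg n = frac-nonNeg n 1

ι-mono : ∀ {m n} → m ≤ n → ι m ≤ℚ ι n
ι-mono {m} le with ℕP.m≤n⇒∃[o]m+o≡n le
... | o , refl = QP.≤-trans (QP.≤-reflexive (sym (QP.+-identityʳ (ι m))))
      (QP.≤-trans (QP.+-monoʳ-≤ (ι m) (ι-nonNeg o)) (QP.≤-reflexive (sym (ι-+ m o))))

pow-nonNeg : ∀ {a} → 0ℚ ≤ℚ a → ∀ k → 0ℚ ≤ℚ a ^ℚ k
pow-nonNeg a≥0 zero = QP.nonNegative⁻¹ 1ℚ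
pow-nonNeg a≥0 (suc k) = *-nonNeg a≥0 (pow-nonNeg a≥0 k)

pow-mono : ∀ {a c} → 0ℚ ≤ℚ a → a ≤ℚ c → ∀ k → a ^ℚ k ≤ℚ c ^ℚ k
pow-mono a≥0 a≤c zero = QP.≤-refl
pow-mono a≥0 a≤c (suc k) = QP.≤-trans (*-monoʳ-≤ (pow-nonNeg a≥0 k) a≤c)
  (*-monoˡ-≤ (QP.≤-trans a≥0 a≤c) (pow-mono a≥0 a≤c k))

pow-* : ∀ a c k → (a Q.* c) ^ℚ k ≡ a ^ℚ k Q.* c ^ℚ k
pow-* a c zero = refl
pow-* a c (suc k) = trans (cong ((a Q.* c) Q.*_) (pow-* a c k))
  (solve 4 (λ a c x y → (a :* c) :* (x :* y) := (a :* x) :* (c :* y)) refl a c (a ^ℚ k) (c ^ℚ k))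
  where open QS.+-*-Solver

ι-^ : ∀ m k → ι m ^ℚ k ≡ ι (m ^ k)
ι-^ m zero = refl
ι-^ m (suc k) = trans (cong (ι m Q.*_) (ι-^ m k)) (sym (ι-* m (m ^ k)))

-- multichoose M k = number of multisets of size k from M elements
-- = the coefficient of a^k in (1 - a)^{-M}.
multichoose : ℕ → ℕ → ℕ
multichoose M zero = 1
multichoose zero (suc k) = 0
multichoose (suc M) (suc k) = multichoose (suc M) k + multichoose M (suc k)

succ-pow-bound : ∀ M k → suc M ^ suc k ≤ suc k * suc M ^ k + M ^ suc k
succ-pow-bound M zero = ℕP.≤-reflexive
  (solve 1 (λ M → (con 1 :+ M) :* con 1 := con 1 :* con 1 :+ M :* con 1) refl M)
  where open ℕS.+-*-Solver
succ-pow-bound M (suc k) = begin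
    P * P ^ suc k
  ≤⟨ ℕP.*-monoʳ-≤ P (succ-pow-bound M k) ⟩
    P * (suc k * P ^ k + M ^ suc k)
  ≡⟨ solve 4 (λ M k Pk Mk → (con 1 :+ M) :* ((con 1 :+ k) :* Pk :+ Mk)
                := (con 1 :+ k) :* ((con 1 :+ M) :* Pk) :+ M :* Mk :+ Mk)
       refl M k (P ^ k) (M ^ suc k) ⟩
    suc k * P ^ suc k + M ^ suc (suc k) + M ^ suc k
  ≤⟨ ℕP.+-monoʳ-≤ (suc k * P ^ suc k + M ^ suc (suc k)) (ℕP.^-monoˡ-≤ (suc k) (ℕP.n≤1+n M)) ⟩
    suc k * P ^ suc k + M ^ suc (suc k) + P ^ suc k
  ≡⟨ solve 3 (λ x y z → x :+ y :+ z := z :+ x :+ y) refl (suc k * P ^ suc k) (M ^ suc (suc k)) (P ^ suc k) ⟩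
    suc (suc k) * P ^ suc k + M ^ suc (suc k)
  ∎
  where open ℕP.≤-Reasoning
        open ℕS.+-*-Solver
        P : ℕ
        P = suc M

-- M^k/k! ≤ multichoose M k: termwise, e^{aM} ≤ (1 - a)^{-M}.
pow≤factorial*multichoose : ∀ M k → M ^ k ≤ k ! * multichoose M k
pow≤factorial*multichoose M zero = ℕP.≤-refl
pow≤factorial*multichoose zero (suc k) = z≤n
pow≤factorial*multichoose (suc M) (suc k) = begin
    suc M ^ suc k
  ≤⟨ succ-pow-bound M k ⟩
    suc k * suc M ^ k + M ^ suc k
  ≤⟨ ℕP.+-mono-≤ (ℕP.*-monoʳ-≤ (suc k) (pow≤factorial*multichoose (suc M) k))
                 (pow≤factorial*multichoose M (suc k)) ⟩
    suc k * (k ! * x) + suc k ! * y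
  ≡⟨ solve 4 (λ k f x y → (con 1 :+ k) :* (f :* x) :+ ((con 1 :+ k) :* f) :* y
                := ((con 1 :+ k) :* f) :* (x :+ y)) refl k (k !) x y ⟩
    suc k ! * multichoose (suc M) (suc k)
  ∎
  where open ℕP.≤-Reasoning
        open ℕS.+-*-Solver
        x : ℕ
        x = multichoose (suc M) k
        y : ℕ
        y = multichoose M (suc k)

-- The truncated series Σ_{k<K} multichoose M k · a^k of (1 - a)^{-M}.
negBinomialSeries : ℚ → ℕ → ℕ → ℚ
negBinomialSeries a M zero = 0ℚ
negBinomialSeries a M (suc K) = negBinomialSeries a M K Q.+ ι (multichoose M K) Q.* a ^ℚ K

-- Truncation of (1 - a) · (1 - a)^{-(M+1)} = (1 - a)^{-M}, with its exact error term.
negBinomialSeries-step : ∀ a M K →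
  (1ℚ Q.- a) Q.* negBinomialSeries a (suc M) (suc K) Q.+ ι (multichoose (suc M) K) Q.* a ^ℚ suc K
  ≡ negBinomialSeries a M (suc K)
negBinomialSeries-step a M zero =
  solve 2 (λ a x → (con 1ℚ :- a) :* (con 0ℚ :+ x :* con 1ℚ) :+ x :* (a :* con 1ℚ) := con 0ℚ :+ x :* con 1ℚ)
    refl a (ι 1)
  where open QS.+-*-Solver
negBinomialSeries-step a M (suc K) = begin
    (1ℚ Q.- a) Q.* (s Q.+ ι (x' + y') Q.* p) Q.+ ι (x' + y') Q.* (a Q.* p)
  ≡⟨ cong (λ z → (1ℚ Q.- a) Q.* (s Q.+ z Q.* p) Q.+ z Q.* (a Q.* p)) (ι-+ x' y') ⟩
    (1ℚ Q.- a) Q.* (s Q.+ (x Q.+ y) Q.* p) Q.+ (x Q.+ y) Q.* (a Q.* p)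
  ≡⟨ solve 5 (λ a s x y p → (con 1ℚ :- a) :* (s :+ (x :+ y) :* p) :+ (x :+ y) :* (a :* p)
                := ((con 1ℚ :- a) :* s :+ x :* p) :+ y :* p) refl a s x y p ⟩
    ((1ℚ Q.- a) Q.* s Q.+ x Q.* p) Q.+ y Q.* p
  ≡⟨ cong (Q._+ y Q.* p) (negBinomialSeries-step a M K) ⟩
    negBinomialSeries a M (suc K) Q.+ y Q.* p
  ∎
  where open ≡-Reasoning
        open QS.+-*-Solver
        s : ℚ
        s = negBinomialSeries a (suc M) (suc K)
        p : ℚ
        p = a ^ℚ suc K
        x' : ℕ
        x' = multichoose (suc M) K
        y' : ℕ
        y' = multichoose M (suc K)
        x : ℚ
        x = ι x'
        y : ℚ
        y = ι y'

module _ {a : ℚ} (a≥0 : 0ℚ ≤ℚ a) (a≤1 : a ≤ℚ 1ℚ) where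

  1-a≥0 : 0ℚ ≤ℚ 1ℚ Q.- a
  1-a≥0 = QP.≤-trans (QP.≤-reflexive (sym (QP.+-inverseʳ a))) (QP.+-monoˡ-≤ (Q.- a) a≤1)

  -- Dropping the (non-negative) error term of negBinomialSeries-step.
  negBinomialSeries-contract : ∀ M K →
    (1ℚ Q.- a) Q.* negBinomialSeries a (suc M) K ≤ℚ negBinomialSeries a M K
  negBinomialSeries-contract M zero = QP.≤-reflexive (QP.*-zeroʳ (1ℚ Q.- a))
  negBinomialSeries-contract M (suc K) = QP.≤-trans
    (QP.≤-trans (QP.≤-reflexive (sym (QP.+-identityʳ u)))
                (QP.+-monoʳ-≤ u (*-nonNeg (ι-nonNeg (multichoose (suc M) K)) (pow-nonNeg a≥0 (suc K)))))
    (QP.≤-reflexive (negBinomialSeries-step a M K))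
    where u : ℚ
          u = (1ℚ Q.- a) Q.* negBinomialSeries a (suc M) (suc K)

  negBinomialSeries-zero : ∀ K → negBinomialSeries a 0 K ≤ℚ 1ℚ
  negBinomialSeries-zero zero = QP.nonNegative⁻¹ 1ℚ
  negBinomialSeries-zero (suc zero) = QP.≤-refl
  negBinomialSeries-zero (suc (suc K)) = QP.≤-trans
    (QP.≤-reflexive (trans (cong (negBinomialSeries a 0 (suc K) Q.+_) (QP.*-zeroˡ (a ^ℚ suc K)))
                           (QP.+-identityʳ _)))
    (negBinomialSeries-zero (suc K))

  negBinomialSeries-bound : ∀ M K → (1ℚ Q.- a) ^ℚ M Q.* negBinomialSeries a M K ≤ℚ 1ℚ
  negBinomialSeries-bound zero K = QP.≤-trans (QP.≤-reflexive (QP.*-identityˡ _)) (negBinomialSeries-zero K)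
  negBinomialSeries-bound (suc M) K = QP.≤-trans (QP.≤-reflexive reassoc)
    (QP.≤-trans (*-monoˡ-≤ (pow-nonNeg 1-a≥0 M) (negBinomialSeries-contract M K)) (negBinomialSeries-bound M K))
    where
    open QS.+-*-Solver
    reassoc : (1ℚ Q.- a) ^ℚ suc M Q.* negBinomialSeries a (suc M) K
            ≡ (1ℚ Q.- a) ^ℚ M Q.* ((1ℚ Q.- a) Q.* negBinomialSeries a (suc M) K)
    reassoc = solve 3 (λ u q s → (u :* q) :* s := q :* (u :* s)) refl
      (1ℚ Q.- a) ((1ℚ Q.- a) ^ℚ M) (negBinomialSeries a (suc M) K)

  expTerm-bound : ∀ M k → (a Q.* ι M) ^ℚ k Q.* frac 1 (k !) ≤ℚ ι (multichoose M k) Q.* a ^ℚ k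
  expTerm-bound M k = begin
      (a Q.* ι M) ^ℚ k Q.* f
    ≡⟨ cong (Q._* f) (trans (pow-* a (ι M) k) (cong (a ^ℚ k Q.*_) (ι-^ M k))) ⟩
      (a ^ℚ k Q.* ι (M ^ k)) Q.* f
    ≤⟨ *-monoʳ-≤ (frac-nonNeg 1 (k !)) (*-monoˡ-≤ (pow-nonNeg a≥0 k) (ι-mono (pow≤factorial*multichoose M k))) ⟩
      (a ^ℚ k Q.* ι (k ! * c)) Q.* f
    ≡⟨ cong (λ z → (a ^ℚ k Q.* z) Q.* f) (ι-* (k !) c) ⟩
      (a ^ℚ k Q.* (ι (k !) Q.* ι c)) Q.* f
    ≡⟨ solve 4 (λ p x y f → (p :* (x :* y)) :* f := y :* p :* (x :* f)) refl (a ^ℚ k) (ι (k !)) (ι c) f ⟩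
      ι c Q.* a ^ℚ k Q.* (ι (k !) Q.* f)
    ≡⟨ cong (ι c Q.* a ^ℚ k Q.*_) (frac-inverse (k !) (ℕP.1≤n! k)) ⟩
      ι c Q.* a ^ℚ k Q.* 1ℚ
    ≡⟨ QP.*-identityʳ _ ⟩
      ι c Q.* a ^ℚ k
    ∎
    where open QP.≤-Reasoning
          open QS.+-*-Solver
          f : ℚ
          f = frac 1 (k !)
          c : ℕ
          c = multichoose M k

  expPartial≤negBinomialSeries : ∀ M K → expPartial (a Q.* ι M) K ≤ℚ negBinomialSeries a M K
  expPartial≤negBinomialSeries M zero = QP.≤-refl
  expPartial≤negBinomialSeries M (suc K) = QP.+-mono-≤ (expPartial≤negBinomialSeries M K) (expTerm-bound M K)

  expPartial-nonNeg : ∀ M K → 0ℚ ≤ℚ expPartial (a Q.* ι M) K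
  expPartial-nonNeg M zero = QP.≤-refl
  expPartial-nonNeg M (suc K) = QP.+-mono-≤ (expPartial-nonNeg M K)
    (*-nonNeg (pow-nonNeg (*-nonNeg a≥0 (ι-nonNeg M)) K) (frac-nonNeg 1 (K !)))

  expLe-of-powerBound : ∀ M {p} → p ≤ℚ (1ℚ Q.- a) ^ℚ M → ExpLe p (a Q.* ι M)
  expLe-of-powerBound M p≤ K = QP.≤-trans (*-monoʳ-≤ (expPartial-nonNeg M K) p≤)
    (QP.≤-trans (*-monoˡ-≤ (pow-nonNeg 1-a≥0 M) (expPartial≤negBinomialSeries M K)) (negBinomialSeries-bound M K))

χ : Bool → ℕ
χ true = 1
χ false = 0

χ-∧ : ∀ a c → χ (a ∧ c) ≡ χ a * χ c
χ-∧ true c = sym (ℕP.+-identityʳ (χ c))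
χ-∧ false c = refl

χ-not : ∀ c → χ (not c) + χ c ≡ 1
χ-not true = refl
χ-not false = refl

private variable A B : Set

∑ : (A → ℕ) → List A → ℕ
∑ f xs = sum (map f xs)

∑-χ-filter : (p : A → Bool) (xs : List A) → length (filter (λ y → T? (p y)) xs) ≡ ∑ (λ x → χ (p x)) xs
∑-χ-filter p [] = refl
∑-χ-filter p (x ∷ xs) with p x
... | true = cong suc (∑-χ-filter p xs)
... | false = ∑-χ-filter p xs

∑-cong : ∀ {f g : A → ℕ} (xs : List A) → (∀ x → f x ≡ g x) → ∑ f xs ≡ ∑ g xs
∑-cong xs f≗g = cong sum (LP.map-cong f≗g xs)

∑-mono : ∀ {f g : A → ℕ} (xs : List A) → (∀ x → f x ≤ g x) → ∑ f xs ≤ ∑ g xs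
∑-mono [] f≤g = ℕP.≤-refl
∑-mono (x ∷ xs) f≤g = ℕP.+-mono-≤ (f≤g x) (∑-mono xs f≤g)

∑-concatMap : ∀ (f : B → ℕ) (g : A → List B) xs → ∑ f (concatMap g xs) ≡ ∑ (λ x → ∑ f (g x)) xs
∑-concatMap f g [] = refl
∑-concatMap f g (x ∷ xs) =
  trans (trans (cong sum (LP.map-++ f (g x) (concatMap g xs))) (SumP.sum-++ (map f (g x)) (map f (concatMap g xs))))
        (cong (λ z → ∑ f (g x) + z) (∑-concatMap f g xs))

∑-map : ∀ (f : B → ℕ) (h : A → B) xs → ∑ f (map h xs) ≡ ∑ (f ∘ h) xs
∑-map f h xs = cong sum (sym (LP.map-∘ xs))

∑-const : ∀ (c : ℕ) (xs : List A) → ∑ (λ _ → c) xs ≡ length xs * c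
∑-const c [] = refl
∑-const c (x ∷ xs) = cong (λ z → c + z) (∑-const c xs)

∑-count : ∀ (xs : List A) → ∑ (λ _ → 1) xs ≡ length xs
∑-count xs = trans (∑-const 1 xs) (ℕP.*-identityʳ (length xs))

∑-*ˡ : ∀ (c : ℕ) (f : A → ℕ) xs → ∑ (λ x → c * f x) xs ≡ c * ∑ f xs
∑-*ˡ c f [] = sym (ℕP.*-zeroʳ c)
∑-*ˡ c f (x ∷ xs) = trans (cong (λ z → c * f x + z) (∑-*ˡ c f xs)) (sym (ℕP.*-distribˡ-+ c (f x) (∑ f xs)))

∑-*ʳ : ∀ (c : ℕ) (f : A → ℕ) xs → ∑ (λ x → f x * c) xs ≡ ∑ f xs * c
∑-*ʳ c f xs = trans (∑-cong xs (λ x → ℕP.*-comm (f x) c)) (trans (∑-*ˡ c f xs) (ℕP.*-comm c (∑ f xs)))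

∑-+ : ∀ (f g : A → ℕ) xs → ∑ (λ x → f x + g x) xs ≡ ∑ f xs + ∑ g xs
∑-+ f g [] = refl
∑-+ f g (x ∷ xs) = trans (cong (λ z → f x + g x + z) (∑-+ f g xs))
  (solve 4 (λ a b c d → (a :+ b) :+ (c :+ d) := (a :+ c) :+ (b :+ d)) refl (f x) (g x) (∑ f xs) (∑ g xs))
  where open ℕS.+-*-Solver

∑-swap : ∀ (F : A → B → ℕ) xs ys → ∑ (λ a → ∑ (F a) ys) xs ≡ ∑ (λ b → ∑ (λ a → F a b) xs) ys
∑-swap F [] ys = sym (trans (∑-const 0 ys) (ℕP.*-zeroʳ (length ys)))
∑-swap F (x ∷ xs) ys = trans (cong (λ z → ∑ (F x) ys + z) (∑-swap F xs ys))
  (sym (∑-+ (F x) (λ b → ∑ (λ a → F a b) xs) ys))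

∑-member : ∀ (f : A → ℕ) {x xs} → x ∈ xs → f x ≤ ∑ f xs
∑-member f {xs = y ∷ ys} (here refl) = ℕP.m≤m+n (f y) (∑ f ys)
∑-member f {xs = y ∷ ys} (there x∈ys) = ℕP.≤-trans (∑-member f x∈ys) (ℕP.m≤n+m (∑ f ys) (f y))

length-allFin : ∀ n → length (allFin n) ≡ n
length-allFin n = LP.length-tabulate id

and-allFin-suc : ∀ k (f : Fin (suc k) → Bool) →
  and (map f (allFin (suc k))) ≡ f fzero ∧ and (map (f ∘ fsuc) (allFin k))
and-allFin-suc k f =
  cong (λ z → f fzero ∧ and z) (trans (LP.map-tabulate fsuc f) (sym (LP.map-tabulate id (f ∘ fsuc))))

-- Counting in Gₙ and in the configuration space of the balls.
module Counting {N : ℕ} (G : BipartiteGraph N) where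
  open BipartiteGraph G

  near : ∀ {n} → Vec (Fin N) n → Vec (Fin N) n → Bool
  near = nearₙ G

  avoidsAll : ∀ {n k} → Vec (Fin N) n → Vec (Vec (Fin N) n) k → Bool
  avoidsAll {k = k} x c = and (map (λ j → not (near x (lookup c j))) (allFin k))

  avoidsAll-cons : ∀ {n k} x w (c : Vec (Vec (Fin N) n) k) →
    avoidsAll x (w ∷ c) ≡ not (near x w) ∧ avoidsAll x c
  avoidsAll-cons {k = k} x w c = and-allFin-suc k (λ j → not (near x (lookup (w ∷ c) j)))

  isolated-zero : ∀ {n k} w (c : Vec (Vec (Fin N) n) k) → isolated G (w ∷ c) fzero ≡ avoidsAll w c
  isolated-zero {k = k} w c = and-allFin-suc k (λ j → does (fzero ≟ j) ∨ not (near w (lookup (w ∷ c) j)))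

  isolated-suc : ∀ {n k} w (c : Vec (Vec (Fin N) n) k) i →
    isolated G (w ∷ c) (fsuc i) ≡ not (near (lookup c i) w) ∧ isolated G c i
  isolated-suc {k = k} w c i =
    and-allFin-suc k (λ j → does (fsuc i ≟ j) ∨ not (near (lookup c i) (lookup (w ∷ c) j)))

  ∑-configs-suc : ∀ n k (F : Vec (Vec (Fin N) n) (suc k) → ℕ) →
    ∑ F (configs G n (suc k)) ≡ ∑ (λ w → ∑ (λ c → F (w ∷ c)) (configs G n k)) (words G n)
  ∑-configs-suc n k F = trans (∑-concatMap F (λ w → map (w ∷_) (configs G n k)) (words G n))
    (∑-cong (words G n) (λ w → ∑-map F (w ∷_) (configs G n k)))

  length-words : ∀ n → length (words G n) ≡ N ^ n
  length-words zero = refl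
  length-words (suc n) = begin
      length (concatMap extend (allFin N))
    ≡⟨ sym (∑-count (concatMap extend (allFin N))) ⟩
      ∑ (λ _ → 1) (concatMap extend (allFin N))
    ≡⟨ ∑-concatMap (λ _ → 1) extend (allFin N) ⟩
      ∑ (λ a → ∑ (λ _ → 1) (extend a)) (allFin N)
    ≡⟨ ∑-cong (allFin N) (λ a → trans (∑-count (extend a))
                                  (trans (LP.length-map (a ∷_) (words G n)) (length-words n))) ⟩
      ∑ (λ _ → N ^ n) (allFin N)
    ≡⟨ trans (∑-const (N ^ n) (allFin N)) (cong (_* N ^ n) (length-allFin N)) ⟩
      N * N ^ n
    ∎
    where open ≡-Reasoning
          extend : Fin N → List (Vec (Fin N) (suc n))
          extend a = map (a ∷_) (words G n)

  avoidCount : ∀ {n} → Vec (Fin N) n → ℕ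
  avoidCount {n} x = ∑ (λ w → χ (not (near x w))) (words G n)

  module _ (n e : ℕ) (avoid≤ : ∀ (x : Vec (Fin N) n) → avoidCount x ≤ e) where

    avoidsAll-count : ∀ k (x : Vec (Fin N) n) → ∑ (λ c → χ (avoidsAll x c)) (configs G n k) ≤ e ^ k
    avoidsAll-count zero x = ℕP.≤-refl
    avoidsAll-count (suc k) x = begin
        ∑ (λ c → χ (avoidsAll x c)) (configs G n (suc k))
      ≡⟨ ∑-configs-suc n k (λ c → χ (avoidsAll x c)) ⟩
        ∑ (λ w → ∑ (λ c → χ (avoidsAll x (w ∷ c))) (configs G n k)) (words G n)
      ≡⟨ ∑-cong (words G n) (λ w →
           trans (∑-cong (configs G n k) (λ c → trans (cong χ (avoidsAll-cons x w c)) (χ-∧ (not (near x w)) _)))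
                 (∑-*ˡ (χ (not (near x w))) (λ c → χ (avoidsAll x c)) (configs G n k))) ⟩
        ∑ (λ w → χ (not (near x w)) * ∑ (λ c → χ (avoidsAll x c)) (configs G n k)) (words G n)
      ≤⟨ ∑-mono (words G n) (λ w → ℕP.*-monoʳ-≤ (χ (not (near x w))) (avoidsAll-count k x)) ⟩
        ∑ (λ w → χ (not (near x w)) * e ^ k) (words G n)
      ≡⟨ ∑-*ʳ (e ^ k) (λ w → χ (not (near x w))) (words G n) ⟩
        avoidCount x * e ^ k
      ≤⟨ ℕP.*-monoˡ-≤ (e ^ k) (avoid≤ x) ⟩
        e * e ^ k
      ∎
      where open ℕP.≤-Reasoning

    isolated-count : ∀ k (i : Fin (suc k)) → ∑ (λ c → χ (isolated G c i)) (configs G n (suc k)) ≤ N ^ n * e ^ k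
    isolated-count k fzero = begin
        ∑ (λ c → χ (isolated G c fzero)) (configs G n (suc k))
      ≡⟨ ∑-configs-suc n k (λ c → χ (isolated G c fzero)) ⟩
        ∑ (λ w → ∑ (λ c → χ (isolated G (w ∷ c) fzero)) (configs G n k)) (words G n)
      ≡⟨ ∑-cong (words G n) (λ w → ∑-cong (configs G n k) (λ c → cong χ (isolated-zero w c))) ⟩
        ∑ (λ w → ∑ (λ c → χ (avoidsAll w c)) (configs G n k)) (words G n)
      ≤⟨ ∑-mono (words G n) (λ w → avoidsAll-count k w) ⟩
        ∑ (λ w → e ^ k) (words G n)
      ≡⟨ trans (∑-const (e ^ k) (words G n)) (cong (_* e ^ k) (length-words n)) ⟩
        N ^ n * e ^ k
      ∎
      where open ℕP.≤-Reasoning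
    isolated-count (suc k) (fsuc i) = begin
        ∑ (λ c → χ (isolated G c (fsuc i))) cs₂
      ≡⟨ ∑-configs-suc n (suc k) (λ c → χ (isolated G c (fsuc i))) ⟩
        ∑ (λ w → ∑ (λ c → χ (isolated G (w ∷ c) (fsuc i))) cs₁) (words G n)
      ≡⟨ ∑-cong (words G n) (λ w → ∑-cong cs₁ (λ c →
           trans (cong χ (isolated-suc w c i)) (χ-∧ (not (near (lookup c i) w)) (isolated G c i)))) ⟩
        ∑ (λ w → ∑ (λ c → χ (not (near (lookup c i) w)) * χ (isolated G c i)) cs₁) (words G n)
      ≡⟨ ∑-swap (λ w c → χ (not (near (lookup c i) w)) * χ (isolated G c i)) (words G n) cs₁ ⟩
        ∑ (λ c → ∑ (λ w → χ (not (near (lookup c i) w)) * χ (isolated G c i)) (words G n)) cs₁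
      ≡⟨ ∑-cong cs₁ (λ c → ∑-*ʳ (χ (isolated G c i)) (λ w → χ (not (near (lookup c i) w))) (words G n)) ⟩
        ∑ (λ c → avoidCount (lookup c i) * χ (isolated G c i)) cs₁
      ≤⟨ ∑-mono cs₁ (λ c → ℕP.*-monoˡ-≤ (χ (isolated G c i)) (avoid≤ (lookup c i))) ⟩
        ∑ (λ c → e * χ (isolated G c i)) cs₁
      ≡⟨ ∑-*ˡ e (λ c → χ (isolated G c i)) cs₁ ⟩
        e * ∑ (λ c → χ (isolated G c i)) cs₁
      ≤⟨ ℕP.*-monoʳ-≤ e (isolated-count k i) ⟩
        e * (N ^ n * e ^ k)
      ≡⟨ x∙yz≈y∙xz e (N ^ n) (e ^ k) ⟩
        N ^ n * (e * e ^ k)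
      ∎
      where open ℕP.≤-Reasoning
            cs₁ : List (Vec (Vec (Fin N) n) (suc k))
            cs₁ = configs G n (suc k)
            cs₂ : List (Vec (Vec (Fin N) n) (suc (suc k)))
            cs₂ = configs G n (suc (suc k))

    isolated-total : ∀ M → ∑ (countIsolated G) (configs G n (suc M)) ≤ suc M * (N ^ n * e ^ M)
    isolated-total M = begin
        ∑ (countIsolated G) cs
      ≡⟨ ∑-cong cs (λ c → ∑-χ-filter (isolated G c) (allFin (suc M))) ⟩
        ∑ (λ c → ∑ (λ i → χ (isolated G c i)) (allFin (suc M))) cs
      ≡⟨ ∑-swap (λ c i → χ (isolated G c i)) cs (allFin (suc M)) ⟩
        ∑ (λ i → ∑ (λ c → χ (isolated G c i)) cs) (allFin (suc M))
      ≤⟨ ∑-mono (allFin (suc M)) (isolated-count M) ⟩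
        ∑ (λ i → N ^ n * e ^ M) (allFin (suc M))
      ≡⟨ trans (∑-const _ (allFin (suc M))) (cong (_* (N ^ n * e ^ M)) (length-allFin (suc M))) ⟩
        suc M * (N ^ n * e ^ M)
      ∎
      where open ℕP.≤-Reasoning
            cs : List (Vec (Vec (Fin N) n) (suc M))
            cs = configs G n (suc M)

  E-irreflexive : ∀ b → E b b ≡ false
  E-irreflexive b with E b b in eq
  ... | true = ⊥-elim (E-across b b (subst T (sym eq) _) refl)
  ... | false = refl

  postAdj-letter : ∀ b a → T (E b a) → T (postAdj G (b ∷ []) (a ∷ []))
  postAdj-letter b a e with E-across b a e
  ... | across with E b a | side b | side a
  ... | true | true | true = ⊥-elim (across refl)
  ... | true | true | false = _
  ... | true | false | true = _
  ... | true | false | false = ⊥-elim (across refl)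

  -- The one-letter word a is near b if a = b or a is a G-neighbour of b
  -- (never both, G being loopless).
  near-letter : ∀ b a → χ (does (b ≟ a)) + χ (E b a) ≤ χ (near (b ∷ []) (a ∷ []))
  near-letter b a with b ≟ a
  ... | yes refl rewrite E-irreflexive b = ℕP.≤-refl
  ... | no _ = χ-T (E b a) (postAdj-letter b a)
    where
    χ-T : ∀ u {v} → (T u → T v) → χ u ≤ χ v
    χ-T false u⇒v = z≤n
    χ-T true {true} u⇒v = ℕP.≤-refl
    χ-T true {false} u⇒v = ⊥-elim (u⇒v _)

  near-cons : ∀ {n} b (x w : Vec (Fin N) n) → near (b ∷ x) (b ∷ w) ≡ near x w
  near-cons b x w rewrite dec-true (b ≟ b) refl = refl

  nearCount : ∀ {n} → Vec (Fin N) n → ℕ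
  nearCount {n} x = ∑ (λ w → χ (near x w)) (words G n)

  avoidCount+nearCount : ∀ {n} (x : Vec (Fin N) n) → avoidCount x + nearCount x ≡ N ^ n
  avoidCount+nearCount {n} x = begin
      avoidCount x + nearCount x
    ≡⟨ sym (∑-+ (λ w → χ (not (near x w))) (λ w → χ (near x w)) (words G n)) ⟩
      ∑ (λ w → χ (not (near x w)) + χ (near x w)) (words G n)
    ≡⟨ ∑-cong (words G n) (λ w → χ-not (near x w)) ⟩
      ∑ (λ _ → 1) (words G n)
    ≡⟨ trans (∑-count (words G n)) (length-words n) ⟩
      N ^ n
    ∎
    where open ≡-Reasoning

  -- With minimal degree d, every nonempty word is near at least d + 1 words:
  -- itself and the words differing from it in the first letter only, by a G-edge.
  module _ (d : ℕ) (minDeg : IsMinDegree G d) where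

    nearCount-bound : ∀ {n} (x : Vec (Fin N) (suc n)) → suc d ≤ nearCount x
    nearCount-bound {zero} (b ∷ []) = begin
        1 + d
      ≤⟨ ℕP.+-mono-≤ (subst (λ z → χ z ≤ ∑ (λ a → χ (does (b ≟ a))) (allFin N)) (dec-true (b ≟ b) refl)
                             (∑-member (λ a → χ (does (b ≟ a))) (∈-allFin b)))
                     (subst (d ≤_) (∑-χ-filter (E b) (allFin N)) (proj₁ minDeg b)) ⟩
        ∑ (λ a → χ (does (b ≟ a))) (allFin N) + ∑ (λ a → χ (E b a)) (allFin N)
      ≡⟨ sym (∑-+ _ _ (allFin N)) ⟩
        ∑ (λ a → χ (does (b ≟ a)) + χ (E b a)) (allFin N)
      ≤⟨ ∑-mono (allFin N) (λ a → ℕP.≤-trans (near-letter b a) (ℕP.m≤m+n _ 0)) ⟩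
        ∑ (λ a → χ (near (b ∷ []) (a ∷ [])) + 0) (allFin N)
      ≡⟨ sym (∑-concatMap (λ w → χ (near (b ∷ []) w)) (λ a → map (a ∷_) ([] ∷ [])) (allFin N)) ⟩
        nearCount (b ∷ [])
      ∎
      where open ℕP.≤-Reasoning
    nearCount-bound {suc n} (b ∷ x) = begin
        suc d
      ≤⟨ nearCount-bound x ⟩
        nearCount x
      ≡⟨ sym (trans (∑-map (λ w → χ (near (b ∷ x) w)) (b ∷_) (words G (suc n)))
                    (∑-cong (words G (suc n)) (λ w → cong χ (near-cons b x w)))) ⟩
        ∑ (λ w → χ (near (b ∷ x) w)) (extend b)
      ≤⟨ ∑-member (λ a → ∑ (λ w → χ (near (b ∷ x) w)) (extend a)) (∈-allFin b) ⟩
        ∑ (λ a → ∑ (λ w → χ (near (b ∷ x) w)) (extend a)) (allFin N)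
      ≡⟨ sym (∑-concatMap (λ w → χ (near (b ∷ x) w)) extend (allFin N)) ⟩
        nearCount (b ∷ x)
      ∎
      where open ℕP.≤-Reasoning
            extend : Fin N → List (Vec (Fin N) (suc (suc n)))
            extend a = map (a ∷_) (words G (suc n))

    avoidCount-bound : ∀ n (x : Vec (Fin N) n) → avoidCount x ≤ N ^ n ∸ suc d
    avoidCount-bound zero [] = z≤n
    avoidCount-bound (suc n) x = begin
        avoidCount x
      ≡⟨ sym (ℕP.m+n∸n≡m (avoidCount x) (nearCount x)) ⟩
        avoidCount x + nearCount x ∸ nearCount x
      ≡⟨ cong (_∸ nearCount x) (avoidCount+nearCount x) ⟩
        N ^ suc n ∸ nearCount x
      ≤⟨ ℕP.∸-monoʳ-≤ (N ^ suc n) (nearCount-bound x) ⟩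
        N ^ suc n ∸ suc d
      ∎
      where open ℕP.≤-Reasoning

ratio-bound : ∀ W M e T → 1 ≤ W → T ≤ suc M * (W * e ^ M) →
  frac T (suc M * W ^ suc M) ≤ℚ (ι e Q.* frac 1 W) ^ℚ M
ratio-bound W M e T W≥1 T≤ = begin
    frac T D
  ≡⟨ frac-split T D (ℕP.*-mono-≤ {1} {suc M} (s≤s z≤n) (pow-positive W (suc M) W≥1)) ⟩
    ι T Q.* frac 1 D
  ≤⟨ *-monoʳ-≤ (frac-nonNeg 1 D) (ι-mono T≤) ⟩
    ι (suc M * (W * e ^ M)) Q.* frac 1 D
  ≡⟨ cong₂ Q._*_ numerator denominator ⟩
    (ι (suc M) Q.* (ι W Q.* ι e ^ℚ M)) Q.* (frac 1 (suc M) Q.* (w Q.* w ^ℚ M))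
  ≡⟨ solve 6 (λ a b c d f g → (a :* (b :* c)) :* (d :* (f :* g)) := (a :* d) :* ((b :* f) :* (c :* g))) refl
       (ι (suc M)) (ι W) (ι e ^ℚ M) (frac 1 (suc M)) w (w ^ℚ M) ⟩
    (ι (suc M) Q.* frac 1 (suc M)) Q.* ((ι W Q.* w) Q.* (ι e ^ℚ M Q.* w ^ℚ M))
  ≡⟨ cong₂ (λ u v → u Q.* (v Q.* (ι e ^ℚ M Q.* w ^ℚ M))) (frac-inverse (suc M) (s≤s z≤n)) (frac-inverse W W≥1) ⟩
    1ℚ Q.* (1ℚ Q.* (ι e ^ℚ M Q.* w ^ℚ M))
  ≡⟨ trans (QP.*-identityˡ _) (trans (QP.*-identityˡ _) (sym (pow-* (ι e) w M))) ⟩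
    (ι e Q.* w) ^ℚ M
  ∎
  where open QP.≤-Reasoning
        open QS.+-*-Solver
        D : ℕ
        D = suc M * W ^ suc M
        w : ℚ
        w = frac 1 W
        numerator : ι (suc M * (W * e ^ M)) ≡ ι (suc M) Q.* (ι W Q.* ι e ^ℚ M)
        numerator = trans (ι-* (suc M) (W * e ^ M))
          (cong (ι (suc M) Q.*_) (trans (ι-* W (e ^ M)) (cong (ι W Q.*_) (sym (ι-^ e M)))))
        denominator : frac 1 D ≡ frac 1 (suc M) Q.* (w Q.* w ^ℚ M)
        denominator = trans (frac-inverse-* (suc M) (W ^ suc M) (s≤s z≤n) (pow-positive W (suc M) W≥1))
          (cong (frac 1 (suc M) Q.*_) (frac-inverse-^ W (suc M) W≥1))

module _ (W : ℕ) (W≥1 : 1 ≤ W) (dd : ℕ) {p : ℚ} where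

  private
    w : ℚ
    w = frac 1 W
    a : ℚ
    a = ι dd Q.* w

    exponent-split : ∀ M → frac dd 1 Q.* frac M W ≡ a Q.* ι M
    exponent-split M = trans (cong (ι dd Q.*_) (frac-split M W W≥1))
      (solve 3 (λ x m f → x :* (m :* f) := (x :* f) :* m) refl (ι dd) (ι M) w)
      where open QS.+-*-Solver

  expLe-of-ratioBound : ∀ M e → e + dd ≤ W → p ≤ℚ (ι e Q.* w) ^ℚ M → ExpLe p (frac dd 1 Q.* frac M W)
  expLe-of-ratioBound M e e+dd≤W p≤ = subst (ExpLe p) (sym (exponent-split M))
    (expLe-of-powerBound a≥0 a≤1 M (QP.≤-trans p≤ (pow-mono (*-nonNeg (ι-nonNeg e) w≥0) e/W≤1-a M)))
    where
    open QS.+-*-Solver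
    w≥0 : 0ℚ ≤ℚ w
    w≥0 = frac-nonNeg 1 W
    a≥0 : 0ℚ ≤ℚ a
    a≥0 = *-nonNeg (ι-nonNeg dd) w≥0
    sum≤1 : ι e Q.* w Q.+ a ≤ℚ 1ℚ
    sum≤1 = QP.≤-trans
      (QP.≤-reflexive (trans (sym (QP.*-distribʳ-+ w (ι e) (ι dd))) (cong (Q._* w) (sym (ι-+ e dd)))))
      (QP.≤-trans (*-monoʳ-≤ w≥0 (ι-mono e+dd≤W)) (QP.≤-reflexive (frac-inverse W W≥1)))
    a≤1 : a ≤ℚ 1ℚ
    a≤1 = QP.≤-trans (QP.≤-trans (QP.≤-reflexive (sym (QP.+-identityˡ a)))
                                  (QP.+-monoˡ-≤ a (*-nonNeg (ι-nonNeg e) w≥0))) sum≤1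
    e/W≤1-a : ι e Q.* w ≤ℚ 1ℚ Q.- a
    e/W≤1-a = QP.≤-trans (QP.≤-reflexive (solve 2 (λ x a → x := (x :+ a) :- a) refl (ι e Q.* w) a))
                         (QP.+-monoˡ-≤ (Q.- a) sum≤1)

  -- The degenerate case e = 0: p vanishes unless M = 0, where the exponent is 0.
  expLe-of-zeroBound : ∀ M → 0ℚ ≤ℚ p → p ≤ℚ (ι 0 Q.* w) ^ℚ M → ExpLe p (frac dd 1 Q.* frac M W)
  expLe-of-zeroBound zero p≥0 p≤ = subst (ExpLe p) (sym (trans (exponent-split 0) (QP.*-zeroʳ a)))
    (expLe-of-powerBound {0ℚ} QP.≤-refl (QP.nonNegative⁻¹ 1ℚ) 0 p≤)
  expLe-of-zeroBound (suc M) p≥0 p≤ K =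
    QP.≤-trans (QP.≤-reflexive (trans (cong (Q._* E) p≡0) (QP.*-zeroˡ E))) (QP.nonNegative⁻¹ 1ℚ)
    where
    E : ℚ
    E = expPartial (frac dd 1 Q.* frac (suc M) W) K
    vanish : (ι 0 Q.* w) ^ℚ suc M ≡ 0ℚ
    vanish = trans (cong (Q._* (ι 0 Q.* w) ^ℚ M) (QP.*-zeroˡ w)) (QP.*-zeroˡ ((ι 0 Q.* w) ^ℚ M))
    p≡0 : p ≡ 0ℚ
    p≡0 = QP.≤-antisym (QP.≤-trans p≤ (QP.≤-reflexive vanish)) p≥0

probIsolated-nonNeg : ∀ {N} (G : BipartiteGraph N) n M → 0ℚ ≤ℚ probIsolated G n M
probIsolated-nonNeg {N} G n M =
  frac-nonNeg (∑ (countIsolated G) (configs G n (suc M))) (suc M * (N ^ n) ^ suc M)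

alphabet-nonEmpty : ∀ {N} → BipartiteGraph N → 1 ≤ N
alphabet-nonEmpty G with proj₁ (BipartiteGraph.V₁-nonempty G)
... | fzero = s≤s z≤n
... | fsuc _ = s≤s z≤n

probIsolated-bound : ∀ {N} (G : BipartiteGraph N) d → IsMinDegree G d → ∀ n M →
  probIsolated G n M ≤ℚ (ι (N ^ n ∸ suc d) Q.* frac 1 (N ^ n)) ^ℚ M
probIsolated-bound {N} G d minDeg n M =
  ratio-bound (N ^ n) M e _ (pow-positive N n (alphabet-nonEmpty G)) (isolated-total n e (avoidCount-bound d minDeg n) M)
  where open Counting G
        e : ℕ
        e = N ^ n ∸ suc d

isolation-expLe : ∀ {N} (G : BipartiteGraph N) d → IsMinDegree G d → ∀ dd → dd ≤ suc d →
  ∀ n M → ExpLe (probIsolated G n M) (frac dd 1 Q.* frac M (N ^ n))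
isolation-expLe {N} G d minDeg dd dd≤ n M = byCase (suc d ≤? W)
  where
  W : ℕ
  W = N ^ n
  W≥1 : 1 ≤ W
  W≥1 = pow-positive N n (alphabet-nonEmpty G)
  bound : probIsolated G n M ≤ℚ (ι (W ∸ suc d) Q.* frac 1 W) ^ℚ M
  bound = probIsolated-bound G d minDeg n M
  byCase : Dec (suc d ≤ W) → ExpLe (probIsolated G n M) (frac dd 1 Q.* frac M W)
  byCase (yes d<W) = expLe-of-ratioBound W W≥1 dd M (W ∸ suc d)
    (ℕP.≤-trans (ℕP.+-monoʳ-≤ (W ∸ suc d) dd≤) (ℕP.≤-reflexive (ℕP.m∸n+n≡m d<W))) bound
  -- Here d + 1 > Nⁿ, so no word avoids any other: e = 0.
  byCase (no d≮W) = expLe-of-zeroBound W W≥1 dd M (probIsolated-nonNeg G n M)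
    (subst (λ e → probIsolated G n M ≤ℚ (ι e Q.* frac 1 W) ^ℚ M) e≡0 bound)
    where e≡0 : W ∸ suc d ≡ 0
          e≡0 = ℕP.m≤n⇒m∸n≡0 (ℕP.≤-trans (ℕP.n≤1+n W) (ℕP.≰⇒> d≮W))

-- e^y ≥ 1 + y: the first two terms of the exponential series.
expLe-linear : ∀ p y → ExpLe p y → p Q.* (1ℚ Q.+ y) ≤ℚ 1ℚ
expLe-linear p y p≤e^-y = QP.≤-trans (QP.≤-reflexive (cong (p Q.*_) (sym twoTerms))) (p≤e^-y 2)
  where open QS.+-*-Solver
        twoTerms : expPartial y 2 ≡ 1ℚ Q.+ y
        twoTerms = solve 1 (λ y → (con 0ℚ :+ con 1ℚ :* con 1ℚ) :+ (y :* con 1ℚ) :* con 1ℚ := con 1ℚ :+ y) refl y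

archimedean : ∀ ε → 0ℚ < ε → ∃ λ B → 1ℚ ≤ℚ ε Q.* ι B
archimedean ε@(mkℚ (+ suc n) q _) _ = suc q , QP.≤-trans (ι-mono {1} {suc n} (s≤s z≤n)) (QP.≤-reflexive (sym εq≡n))
  where
  εq≡n : ε Q.* ι (suc q) ≡ ι (suc n)
  εq≡n = begin
      ε Q.* ι (suc q)
    ≡⟨ cong (Q._* ι (suc q)) (trans (sym (QP.↥p/↧p≡p ε)) (frac-split (suc n) (suc q) (s≤s z≤n))) ⟩
      ι (suc n) Q.* frac 1 (suc q) Q.* ι (suc q)
    ≡⟨ solve 3 (λ a f b → a :* f :* b := a :* (b :* f)) refl (ι (suc n)) (frac 1 (suc q)) (ι (suc q)) ⟩
      ι (suc n) Q.* (ι (suc q) Q.* frac 1 (suc q))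
    ≡⟨ trans (cong (ι (suc n) Q.*_) (frac-inverse (suc q) (s≤s z≤n))) (QP.*-identityʳ _) ⟩
      ι (suc n)
    ∎
    where open ≡-Reasoning
          open QS.+-*-Solver
archimedean (mkℚ (+ zero) q _) (Q.*<* 0<0) = ⊥-elim (ℤP.<-irrefl refl 0<0)
archimedean (mkℚ ℤ.-[1+ n ] q _) (Q.*<* ())

small-of-linearBound : ∀ {p ε y} B → 0ℚ ≤ℚ p → 0ℚ < ε → 1ℚ ≤ℚ ε Q.* ι B → ι B ≤ℚ y →
  p Q.* (1ℚ Q.+ y) ≤ℚ 1ℚ → p ≤ℚ ε
small-of-linearBound {p} {ε} {y} B p≥0 ε>0 εB≥1 B≤y p[1+y]≤1 =
  QP.*-cancelʳ-≤-pos r {{Q.positive r>0}} (begin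
    p Q.* r             ≤⟨ *-monoˡ-≤ p≥0 (QP.+-monoʳ-≤ 1ℚ B≤y) ⟩
    p Q.* (1ℚ Q.+ y)    ≤⟨ p[1+y]≤1 ⟩
    1ℚ                  ≤⟨ εB≥1 ⟩
    ε Q.* ι B           ≤⟨ *-monoˡ-≤ (QP.<⇒≤ ε>0) B≤r ⟩
    ε Q.* r             ∎)
  where
  open QP.≤-Reasoning
  r : ℚ
  r = 1ℚ Q.+ ι B
  B≤r : ι B ≤ℚ r
  B≤r = QP.≤-trans (QP.≤-reflexive (sym (QP.+-identityˡ (ι B))))
                   (QP.+-monoˡ-≤ (ι B) (QP.nonNegative⁻¹ 1ℚ))
  r>0 : 0ℚ < r
  r>0 = QP.<-≤-trans (QP.positive⁻¹ 1ℚ)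
          (QP.≤-trans (QP.≤-reflexive (sym (QP.+-identityʳ 1ℚ))) (QP.+-monoʳ-≤ 1ℚ (ι-nonNeg B)))

exponent-lower-bound : ∀ W → 1 ≤ W → ∀ d M B → B * W ≤ M → ι B ≤ℚ frac (suc d) 1 Q.* frac M W
exponent-lower-bound W W≥1 d M B BW≤M = begin
    ι B
  ≡⟨ sym (trans (cong (ι B Q.*_) (frac-inverse W W≥1)) (QP.*-identityʳ (ι B))) ⟩
    ι B Q.* (ι W Q.* w)
  ≡⟨ trans (sym (QP.*-assoc (ι B) (ι W) w)) (cong (Q._* w) (sym (ι-* B W))) ⟩
    ι (B * W) Q.* w
  ≤⟨ *-monoʳ-≤ (frac-nonNeg 1 W) (ι-mono BW≤M) ⟩
    ι M Q.* w
  ≡⟨ sym (QP.*-identityˡ (ι M Q.* w)) ⟩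
    1ℚ Q.* (ι M Q.* w)
  ≤⟨ *-monoʳ-≤ (*-nonNeg (ι-nonNeg M) (frac-nonNeg 1 W)) (ι-mono {1} {suc d} (s≤s z≤n)) ⟩
    ι (suc d) Q.* (ι M Q.* w)
  ≡⟨ cong (ι (suc d) Q.*_) (sym (frac-split M W W≥1)) ⟩
    frac (suc d) 1 Q.* frac M W
  ∎
  where open QP.≤-Reasoning
        w : ℚ
        w = frac 1 W

mainTheorem12 : (N : ℕ) (G : BipartiteGraph N) (dmin : ℕ) → IsMinDegree G dmin →
    (M : ℕ → ℕ) →
    (∀ (B : ℕ) → ∃ λ n₀ → ∀ n → n₀ ≤ n → B * N ^ n ≤ M n) →
    (∀ n → ExpLe (probIsolated G n (M n)) (frac dmin 1 *ℚ frac (M n) (N ^ n)))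
    ×
    (∀ (ε : ℚ) → 0ℚ < ε → ∃ λ n₀ → ∀ n → n₀ ≤ n → probIsolated G n (M n) ≤ℚ ε)
mainTheorem12 N G d minDeg M c→∞ = expBound , tendsToZero
  where
  expBound : ∀ n → ExpLe (probIsolated G n (M n)) (frac d 1 *ℚ frac (M n) (N ^ n))
  expBound n = isolation-expLe G d minDeg d (ℕP.n≤1+n d) n (M n)

  -- Use the bound with d + 1 (always positive) in place of d, and e^y ≥ 1 + y.
  tendsToZero : ∀ (ε : ℚ) → 0ℚ < ε → ∃ λ n₀ → ∀ n → n₀ ≤ n → probIsolated G n (M n) ≤ℚ ε
  tendsToZero ε ε>0 with archimedean ε ε>0
  ... | B , εB≥1 with c→∞ B
  ... | n₀ , c≥B = n₀ , λ n n≥n₀ → small-of-linearBound B (probIsolated-nonNeg G n (M n)) ε>0 εB≥1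
          (exponent-lower-bound (N ^ n) (pow-positive N n (alphabet-nonEmpty G)) d (M n) B (c≥B n n≥n₀))
          (expLe-linear (probIsolated G n (M n)) _ (isolation-expLe G d minDeg (suc d) ℕP.≤-refl n (M n)))
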